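{- Let $a,b\ge1$ be integers and $n=a+b+1$. The facets of $\Delta(a,b)$ are precisely the sets $A\cup B$ where $A\subseteq V$, $B\subseteq U$, $|A|=a$, $|B|=b$, and $A\cup B$ contains at most one element from each pair $\{u_\nu,v_\nu\}$, $\nu\in[n]$.
   Context: For integers $a,b\ge1$, let $n=a+b+1$ and let $P$ be the $2\times n$ transportation polytope consisting of all real nonnegative $2\times n$ matrices $X=(x_{\mu,\nu})$ with row sums $\sum_\nu x_{1,\nu}=2a+1$, $\sum_\nu x_{2,\nu}=2b+1$ and all column sums $x_{1,\nu}+x_{2,\nu}=2$. This is a simple polytope of dimension $a+b$ whose facets are exactly the sets $F_{\mu,\nu}=\{X\in P: x_{\mu,\nu}=0\}$, $\mu\in\{1,2\}$, $\nu\in[n]$; a point of $P$ is a vertex iff its support $\{(\mu,\nu):x_{\mu,\nu}>0\}$ is a spanning tree of the complete bipartite graph $K_{2,n}$. $\Delta(a,b)$ denotes the boundary complex of the polar polytope of $P$: its vertex set is $U\cup V$ with $U=\{u_1,\dots,u_n\}$, $V=\{v_1,\dots,v_n\}$, where $u_\nu$ is the vertex polar to the facet $F_{1,\nu}$ and $v_\nu$ the vertex polar to $F_{2,\nu}$; facets of $\Delta(a,b)$ correspond to vertices of $P$ (the facet polar to vertex $X$ consists of the polar vertices of the facets of $P$ containing $X$).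
   Formalization: The transportation polytope P consists of nonnegative 2×n matrices with rational rather than real entries, and its vertices are extreme points tested against rational points of P with rational convex weights. -}

module Defs where

open import Data.Nat as ℕ using (ℕ; zero; suc)
open import Data.Integer using (+_)
open import Data.Rational using (ℚ; 0ℚ; 1ℚ; _/_; _+_; _*_; _-_; _≤_; _<_)
open import Data.Fin using (Fin; zero; suc)
open import Data.Fin.Subset using (Subset; _∈_; _∩_; ⊥; ∣_∣)
open import Data.Product using (Σ; _×_; _,_)
open import Function.Bundles using (_⇔_)
open import Relation.Binary.PropositionalEquality using (_≡_)

⟦_⟧ : ℕ → ℚ
⟦ k ⟧ = + k / 1

Σℚ : ∀ {n} → (Fin n → ℚ) → ℚ
Σℚ {zero}  f = 0ℚ
Σℚ {suc n} f = f zero + Σℚ (λ i → f (suc i))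

Row1 Row2 : Fin 2
Row1 = zero
Row2 = suc zero

Mat : ℕ → Set
Mat n = Fin 2 → Fin n → ℚ

InP : (a b : ℕ) → Mat (a ℕ.+ b ℕ.+ 1) → Set
InP a b X =
  (∀ μ ν → 0ℚ ≤ X μ ν) ×
  (Σℚ (X Row1) ≡ ⟦ 2 ℕ.* a ℕ.+ 1 ⟧) ×
  (Σℚ (X Row2) ≡ ⟦ 2 ℕ.* b ℕ.+ 1 ⟧) ×
  (∀ ν → X Row1 ν + X Row2 ν ≡ ⟦ 2 ⟧)

IsVertex : (a b : ℕ) → Mat (a ℕ.+ b ℕ.+ 1) → Set
IsVertex a b X =
  InP a b X ×
  (∀ (Y Z : Mat (a ℕ.+ b ℕ.+ 1)) (t : ℚ) → InP a b Y → InP a b Z →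
     0ℚ < t → t < 1ℚ →
     (∀ μ ν → X μ ν ≡ t * Y μ ν + (1ℚ - t) * Z μ ν) →
     ∀ μ ν → Y μ ν ≡ Z μ ν)

-- A subset of the vertex set U ∪ V of Δ(a,b) is given by a pair (SU , SV)
-- of subsets of [n]: u_ν is in the set iff ν ∈ SU, v_ν iff ν ∈ SV.
-- It is a facet of Δ(a,b) iff it is the polar facet of some vertex X of P,
-- i.e. it consists exactly of the polar vertices of the facets
-- F_{μ,ν} = {x_{μ,ν} = 0} containing X.
IsFacetΔ : (a b : ℕ) → Subset (a ℕ.+ b ℕ.+ 1) → Subset (a ℕ.+ b ℕ.+ 1) → Set
IsFacetΔ a b SU SV =
  Σ (Mat (a ℕ.+ b ℕ.+ 1)) λ X →
    IsVertex a b X ×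
    (∀ ν → (ν ∈ SU ⇔ X Row1 ν ≡ 0ℚ) × (ν ∈ SV ⇔ X Row2 ν ≡ 0ℚ))

module Submission where

-- A facet is recorded by the pair (SU , SV)
-- of zero patterns of a vertex X of the transportation polytope P: ν ∈ SU
-- iff x₁ν = 0 and ν ∈ SV iff x₂ν = 0.  Every column of a point of P sums
-- to 2, so it is full in row 1 (ν ∈ SV), full in row 2 (ν ∈ SU), or mixed
-- (both entries positive); in particular SU and SV are disjoint.
--
-- Facets to sets: at a vertex at most one column is mixed, because two
-- mixed columns admit a small perturbation (more in one column, less in
-- the other, row 2 compensating) making X a midpoint.  Hence row 1 is twice
-- the indicator of SV plus an excess in [0, 2), and its odd sum 2a + 1
-- forces ∣ SV ∣ = a; row 2 gives ∣ SU ∣ = b.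
--
-- Sets to facets: for disjoint SU, SV of sizes b, a the matrix with entries
-- 0 / 2 on SU ∪ SV and 1 / 1 on the remaining columns lies in P, and
-- counting shows exactly one column is free.  A point of P with a zero
-- entry in every column but one is a vertex: a convex combination equal to
-- it is forced column by column, and on the last column by the row sums.

open import Defs
open import Data.Nat using (ℕ; _+_; _≤_)
open import Data.Fin.Subset using (Subset; _∩_; ⊥; ∣_∣)
open import Data.Product using (_×_)
open import Function.Bundles using (_⇔_)
open import Relation.Binary.PropositionalEquality using (_≡_)

open import Data.Nat using (zero; suc; _*_; _<_)
import Data.Nat.Properties as ℕP
open import Data.Nat.Coprimality as Coprime using (1-coprimeTo)
open import Data.Integer as ℤ using (+_)
import Data.Integer.Properties as ℤP
open import Data.Rational as ℚ using (ℚ; 0ℚ; 1ℚ; ½; mkℚ)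
import Data.Rational.Properties as ℚP
import Function.Properties.Equivalence as ⇔
open import Data.Rational.Solver using (module +-*-Solver)
open import Algebra.Properties.Group ℚP.+-0-group
  using (∙-cancelˡ; ∙-cancelʳ; ⁻¹-involutive; x∙y⁻¹≈ε⇒x≈y; x≈y⇒x∙y⁻¹≈ε)
open import Data.Bool using (Bool; true; false; _∧_)
open import Data.Fin using (Fin; zero; suc)
import Data.Fin.Properties as FinP
open import Data.Fin.Subset using (_∈_)
open import Data.Fin.Subset.Properties using (Empty-unique; p∩q⊆p; p∩q⊆q)
open import Data.Vec using ([]; _∷_; lookup)
import Data.Vec.Properties as VecP
open import Data.Product using (∃; _,_; proj₁; proj₂; swap)
open import Data.Sum using (_⊎_; inj₁; inj₂; [_,_])
open import Data.Empty as Empty using (⊥-elim)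
open import Function using (_∘_; id)
open import Function.Bundles using (mk⇔; Equivalence)
open import Relation.Nullary using (Dec; yes; no)
open import Relation.Nullary.Decidable using (toWitness)
open import Data.Unit using (tt)
open import Relation.Binary.PropositionalEquality
  using (refl; sym; trans; cong; cong₂; subst; subst₂; _≢_; module ≡-Reasoning)
open ≡-Reasoning

⟦⟧-mkℚ : ∀ k → ⟦ k ⟧ ≡ mkℚ (+ k) 0 (Coprime.sym (1-coprimeTo k))
⟦⟧-mkℚ k = ℚP.normalize-coprime (Coprime.sym (1-coprimeTo k))

⟦⟧-+ : ∀ m n → ⟦ m + n ⟧ ≡ ⟦ m ⟧ ℚ.+ ⟦ n ⟧
⟦⟧-+ m n rewrite ⟦⟧-mkℚ m | ⟦⟧-mkℚ n =
  cong (ℚ._/ 1) (sym (cong₂ ℤ._+_ (ℤP.*-identityʳ (+ m)) (ℤP.*-identityʳ (+ n))))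

⟦⟧-nonNeg : ∀ k → 0ℚ ℚ.≤ ⟦ k ⟧
⟦⟧-nonNeg k = ℚP.nonNegative⁻¹ ⟦ k ⟧ {{ℚP.normalize-nonNeg k 1}}

⟦⟧-cancel-≤ : ∀ {m n} → ⟦ m ⟧ ℚ.≤ ⟦ n ⟧ → m ≤ n
⟦⟧-cancel-≤ {m} {n} le rewrite ⟦⟧-mkℚ m | ⟦⟧-mkℚ n with le
... | ℚ.*≤* p = ℤP.drop‿+≤+ (subst₂ ℤ._≤_ (ℤP.*-identityʳ (+ m)) (ℤP.*-identityʳ (+ n)) p)

⟦⟧-cancel-< : ∀ {m n} → ⟦ m ⟧ ℚ.< ⟦ n ⟧ → m < n
⟦⟧-cancel-< {m} {n} lt rewrite ⟦⟧-mkℚ m | ⟦⟧-mkℚ n with lt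
... | ℚ.*<* p = ℤP.drop‿+<+ (subst₂ ℤ._<_ (ℤP.*-identityʳ (+ m)) (ℤP.*-identityʳ (+ n)) p)

⟦⟧≡0⇒≡0 : ∀ {k} → ⟦ k ⟧ ≡ 0ℚ → k ≡ 0
⟦⟧≡0⇒≡0 e = ℕP.n≤0⇒n≡0 (⟦⟧-cancel-≤ (ℚP.≤-reflexive e))

0<⟦2⟧ : 0ℚ ℚ.< ⟦ 2 ⟧
0<⟦2⟧ = ℚP.positive⁻¹ ⟦ 2 ⟧

+-cancelˡ : ∀ x {y z} → x ℚ.+ y ≡ x ℚ.+ z → y ≡ z
+-cancelˡ x {y} {z} = ∙-cancelˡ x y z

+-cancelʳ : ∀ x {y z} → y ℚ.+ x ≡ z ℚ.+ x → y ≡ z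
+-cancelʳ x {y} {z} = ∙-cancelʳ x y z

≤∧≢⇒< : ∀ {p q} → p ℚ.≤ q → p ≢ q → p ℚ.< q
≤∧≢⇒< {p} {q} p≤q p≢q with p ℚP.<? q
... | yes p<q = p<q
... | no  p≮q = ⊥-elim (p≢q (ℚP.≤-antisym p≤q (ℚP.≮⇒≥ p≮q)))

≤-+-nonNeg : ∀ p {q} → 0ℚ ℚ.≤ q → p ℚ.≤ p ℚ.+ q
≤-+-nonNeg p 0≤q = subst (ℚ._≤ p ℚ.+ _) (ℚP.+-identityʳ p) (ℚP.+-monoʳ-≤ p 0≤q)

self-negative⇒0 : ∀ {p} → p ≡ ℚ.- p → p ≡ 0ℚ
self-negative⇒0 {p} p≡-p = begin
  p                 ≡⟨ half-of-double p ⟩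
  ½ ℚ.* (p ℚ.+ p)   ≡⟨ cong (λ q → ½ ℚ.* (p ℚ.+ q)) p≡-p ⟩
  ½ ℚ.* (p ℚ.- p)   ≡⟨ cong (½ ℚ.*_) (ℚP.+-inverseʳ p) ⟩
  ½ ℚ.* 0ℚ          ≡⟨ ℚP.*-zeroʳ ½ ⟩
  0ℚ                ∎
  where
  open +-*-Solver using (solve; _:=_; _:+_; _:*_; con)
  half-of-double : ∀ p → p ≡ ½ ℚ.* (p ℚ.+ p)
  half-of-double = solve 1 (λ p → p := con ½ :* (p :+ p)) refl

convex-zero : ∀ {t y z} → 0ℚ ℚ.< t → t ℚ.< 1ℚ → 0ℚ ℚ.≤ y → 0ℚ ℚ.≤ z →
              t ℚ.* y ℚ.+ (1ℚ ℚ.- t) ℚ.* z ≡ 0ℚ → y ≡ 0ℚ × z ≡ 0ℚ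
convex-zero {t} {y} {z} 0<t t<1 0≤y 0≤z sum≡0 =
  factor-zero 0<t 0≤y (summand-zero 0≤ty 0≤sz sum≡0) ,
  factor-zero 0<s 0≤z (summand-zero 0≤sz 0≤ty (trans (ℚP.+-comm ((1ℚ ℚ.- t) ℚ.* z) (t ℚ.* y)) sum≡0))
  where
  0<s : 0ℚ ℚ.< 1ℚ ℚ.- t
  0<s = subst (ℚ._< 1ℚ ℚ.- t) (ℚP.+-inverseʳ t) (ℚP.+-monoˡ-< (ℚ.- t) t<1)
  product-nonNeg : ∀ {c x} → 0ℚ ℚ.< c → 0ℚ ℚ.≤ x → 0ℚ ℚ.≤ c ℚ.* x
  product-nonNeg {c} 0<c 0≤x = subst (ℚ._≤ c ℚ.* _) (ℚP.*-zeroʳ c)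
    (ℚP.*-monoˡ-≤-nonNeg c {{ℚ.nonNegative (ℚP.<⇒≤ 0<c)}} 0≤x)
  0≤ty = product-nonNeg 0<t 0≤y
  0≤sz = product-nonNeg 0<s 0≤z
  summand-zero : ∀ {A B} → 0ℚ ℚ.≤ A → 0ℚ ℚ.≤ B → A ℚ.+ B ≡ 0ℚ → A ≡ 0ℚ
  summand-zero {A} 0≤A 0≤B A+B≡0 =
    ℚP.≤-antisym (subst (A ℚ.≤_) A+B≡0 (≤-+-nonNeg A 0≤B)) 0≤A
  factor-zero : ∀ {c x} → 0ℚ ℚ.< c → 0ℚ ℚ.≤ x → c ℚ.* x ≡ 0ℚ → x ≡ 0ℚ
  factor-zero {c} 0<c 0≤x cx≡0 = ℚP.≤-antisym
    (ℚP.*-cancelˡ-≤-pos c {{ℚ.positive 0<c}} (ℚP.≤-reflexive (trans cx≡0 (sym (ℚP.*-zeroʳ c)))))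
    0≤x

Σ-cong : ∀ {n} {f g : Fin n → ℚ} → (∀ k → f k ≡ g k) → Σℚ f ≡ Σℚ g
Σ-cong {zero}  f≗g = refl
Σ-cong {suc n} f≗g = cong₂ ℚ._+_ (f≗g zero) (Σ-cong (f≗g ∘ suc))

Σ-+ : ∀ {n} (f g : Fin n → ℚ) → Σℚ (λ k → f k ℚ.+ g k) ≡ Σℚ f ℚ.+ Σℚ g
Σ-+ {zero}  f g = refl
Σ-+ {suc n} f g = trans (cong ((f zero ℚ.+ g zero) ℚ.+_) (Σ-+ (f ∘ suc) (g ∘ suc)))
                        (interchange (f zero) (g zero) (Σℚ (f ∘ suc)) (Σℚ (g ∘ suc)))
  where
  open +-*-Solver using (solve; _:=_; _:+_)
  interchange : ∀ a b c d → (a ℚ.+ b) ℚ.+ (c ℚ.+ d) ≡ (a ℚ.+ c) ℚ.+ (b ℚ.+ d)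
  interchange = solve 4 (λ a b c d → (a :+ b) :+ (c :+ d) := (a :+ c) :+ (b :+ d)) refl

Σ-neg : ∀ {n} (f : Fin n → ℚ) → Σℚ (λ k → ℚ.- f k) ≡ ℚ.- Σℚ f
Σ-neg {zero}  f = refl
Σ-neg {suc n} f = trans (cong (ℚ.- f zero ℚ.+_) (Σ-neg (f ∘ suc)))
                        (sym (ℚP.neg-distrib-+ (f zero) (Σℚ (f ∘ suc))))

Σ-− : ∀ {n} (f g : Fin n → ℚ) → Σℚ (λ k → f k ℚ.- g k) ≡ Σℚ f ℚ.- Σℚ g
Σ-− f g = trans (Σ-+ f (λ k → ℚ.- g k)) (cong (Σℚ f ℚ.+_) (Σ-neg g))

Σ-zero : ∀ {n} (f : Fin n → ℚ) → (∀ k → f k ≡ 0ℚ) → Σℚ f ≡ 0ℚ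
Σ-zero {zero}  f f≡0 = refl
Σ-zero {suc n} f f≡0 = cong₂ ℚ._+_ (f≡0 zero) (Σ-zero (f ∘ suc) (f≡0 ∘ suc))

Σ-single : ∀ {n} (f : Fin n → ℚ) (i : Fin n) → (∀ k → k ≢ i → f k ≡ 0ℚ) → Σℚ f ≡ f i
Σ-single f zero off = begin
  f zero ℚ.+ Σℚ (f ∘ suc) ≡⟨ cong (f zero ℚ.+_) (Σ-zero (f ∘ suc) (λ k → off (suc k) λ ())) ⟩
  f zero ℚ.+ 0ℚ           ≡⟨ ℚP.+-identityʳ (f zero) ⟩
  f zero                  ∎
Σ-single f (suc i) off = begin
  f zero ℚ.+ Σℚ (f ∘ suc) ≡⟨ cong₂ ℚ._+_ (off zero λ ()) (Σ-single (f ∘ suc) i off-tail) ⟩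
  0ℚ ℚ.+ f (suc i)        ≡⟨ ℚP.+-identityˡ (f (suc i)) ⟩
  f (suc i)               ∎
  where
  off-tail : ∀ k → k ≢ i → f (suc k) ≡ 0ℚ
  off-tail k k≢i = off (suc k) (k≢i ∘ FinP.suc-injective)

Σ-agree-at : ∀ {n} (f g : Fin n → ℚ) (i : Fin n) →
             (∀ k → k ≢ i → f k ≡ g k) → Σℚ f ≡ Σℚ g → f i ≡ g i
Σ-agree-at f g i agree Σf≡Σg = x∙y⁻¹≈ε⇒x≈y (f i) (g i) (begin
  f i ℚ.- g i              ≡⟨ Σ-single (λ k → f k ℚ.- g k) i (λ k k≢i → x≈y⇒x∙y⁻¹≈ε (agree k k≢i)) ⟨
  Σℚ (λ k → f k ℚ.- g k)   ≡⟨ Σ-− f g ⟩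
  Σℚ f ℚ.- Σℚ g            ≡⟨ x≈y⇒x∙y⁻¹≈ε Σf≡Σg ⟩
  0ℚ                       ∎)

AtMostOne : ∀ {n} → (Fin n → Set) → Set
AtMostOne {n} P = ∀ (i j : Fin n) → P i → P j → i ≡ j

Σ-atMostOne : ∀ {n} (e : Fin n → ℚ) (P : Fin n → Set) → AtMostOne P →
              (∀ k → e k ≡ 0ℚ ⊎ P k) → Σℚ e ≡ 0ℚ ⊎ ∃ λ i → Σℚ e ≡ e i
Σ-atMostOne {zero}  e P amo support = inj₁ refl
Σ-atMostOne {suc n} e P amo support with support zero
... | inj₂ P0 = inj₂ (zero , Σ-single e zero off)
  where
  off : ∀ k → k ≢ zero → e k ≡ 0ℚ
  off k k≢0 = [ id , (λ Pk → ⊥-elim (k≢0 (amo k zero Pk P0))) ] (support k)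
... | inj₁ e0≡0
  with Σ-atMostOne (e ∘ suc) (P ∘ suc) (λ i j Pi Pj → FinP.suc-injective (amo _ _ Pi Pj))
                   (support ∘ suc)
...   | inj₁ tail≡0       = inj₁ (cong₂ ℚ._+_ e0≡0 tail≡0)
...   | inj₂ (i , tail≡ei) = inj₂ (suc i , trans (cong₂ ℚ._+_ e0≡0 tail≡ei) (ℚP.+-identityˡ _))

-- A row f of P is written as
-- twice the indicator of a set S plus an excess; if the excess lies in
-- [0, 2) and lives on at most one column, the odd row sum 2c + 1 forces
-- ∣ S ∣ = c.

twoIf : Bool → ℚ
twoIf true  = ⟦ 2 ⟧
twoIf false = 0ℚ

Σ-twoIf : ∀ {n} (S : Subset n) → Σℚ (λ k → twoIf (lookup S k)) ≡ ⟦ 2 * ∣ S ∣ ⟧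
Σ-twoIf []          = refl
Σ-twoIf (false ∷ S) = trans (ℚP.+-identityˡ _) (Σ-twoIf S)
Σ-twoIf (true  ∷ S) = begin
  ⟦ 2 ⟧ ℚ.+ Σℚ (λ k → twoIf (lookup S k)) ≡⟨ cong (⟦ 2 ⟧ ℚ.+_) (Σ-twoIf S) ⟩
  ⟦ 2 ⟧ ℚ.+ ⟦ 2 * ∣ S ∣ ⟧                 ≡⟨ ⟦⟧-+ 2 (2 * ∣ S ∣) ⟨
  ⟦ 2 + 2 * ∣ S ∣ ⟧                       ≡⟨ cong ⟦_⟧ (ℕP.*-suc 2 ∣ S ∣) ⟨
  ⟦ 2 * suc ∣ S ∣ ⟧                       ∎

halving : ∀ {s c} → 2 * s ≤ 2 * c + 1 → 2 * c + 1 < 2 * s + 2 → s ≡ c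
halving {s} {c} 2s≤2c+1 2c+1<2s+2 = ℕP.≤-antisym
  (ℕP.m<1+n⇒m≤n (ℕP.*-cancelˡ-< 2 s (suc c) (ℕP.≤-<-trans 2s≤2c+1 (2m+1<2[1+m] c))))
  (ℕP.m<1+n⇒m≤n (ℕP.*-cancelˡ-< 2 c (suc s)
    (ℕP.<-trans (ℕP.m<m+n (2 * c) ℕP.0<1+n) (ℕP.<-≤-trans 2c+1<2s+2 (ℕP.≤-reflexive (2m+2≡2[1+m] s))))))
  where
  2m+2≡2[1+m] : ∀ m → 2 * m + 2 ≡ 2 * suc m
  2m+2≡2[1+m] m = trans (ℕP.+-comm (2 * m) 2) (sym (ℕP.*-suc 2 m))
  2m+1<2[1+m] : ∀ m → 2 * m + 1 < 2 * suc m
  2m+1<2[1+m] m = ℕP.<-≤-trans (ℕP.+-monoʳ-< (2 * m) (ℕP.n<1+n 1)) (ℕP.≤-reflexive (2m+2≡2[1+m] m))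

excess : ∀ {n} → (Fin n → ℚ) → Subset n → Fin n → ℚ
excess f S k = f k ℚ.- twoIf (lookup S k)

Admissible : Set → ℚ → Set
Admissible M e = (e ≡ 0ℚ ⊎ M) × 0ℚ ℚ.≤ e × e ℚ.< ⟦ 2 ⟧

card-from-rowSum : ∀ {n} (f : Fin n → ℚ) (S : Subset n) (P : Fin n → Set) (c : ℕ) →
  AtMostOne P →
  (∀ k → Admissible (P k) (excess f S k)) →
  Σℚ f ≡ ⟦ 2 * c + 1 ⟧ → ∣ S ∣ ≡ c
card-from-rowSum f S P c amo column Σf≡2c+1 = halving
  (⟦⟧-cancel-≤ (subst (⟦ 2 * ∣ S ∣ ⟧ ℚ.≤_) Σf≡2s+r (≤-+-nonNeg _ (proj₁ r-bounds))))
  (⟦⟧-cancel-< (subst₂ ℚ._<_ Σf≡2s+r (sym (⟦⟧-+ (2 * ∣ S ∣) 2))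
                 (ℚP.+-monoʳ-< ⟦ 2 * ∣ S ∣ ⟧ (proj₂ r-bounds))))
  where
  e = excess f S
  r = Σℚ e
  open +-*-Solver using (solve; _:=_; _:+_; _:-_)
  split : ∀ p q → p ≡ q ℚ.+ (p ℚ.- q)
  split = solve 2 (λ p q → p := q :+ (p :- q)) refl
  Σf≡2s+r : ⟦ 2 * ∣ S ∣ ⟧ ℚ.+ r ≡ ⟦ 2 * c + 1 ⟧
  Σf≡2s+r = begin
    ⟦ 2 * ∣ S ∣ ⟧ ℚ.+ r                          ≡⟨ cong (ℚ._+ r) (Σ-twoIf S) ⟨
    Σℚ (λ k → twoIf (lookup S k)) ℚ.+ r          ≡⟨ Σ-+ (λ k → twoIf (lookup S k)) e ⟨
    Σℚ (λ k → twoIf (lookup S k) ℚ.+ e k)        ≡⟨ Σ-cong (λ k → split (f k) (twoIf (lookup S k))) ⟨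
    Σℚ f                                         ≡⟨ Σf≡2c+1 ⟩
    ⟦ 2 * c + 1 ⟧                                ∎
  r-bounds : 0ℚ ℚ.≤ r × r ℚ.< ⟦ 2 ⟧
  r-bounds with Σ-atMostOne e P amo (proj₁ ∘ column)
  ... | inj₁ r≡0       = ℚP.≤-reflexive (sym r≡0) , subst (ℚ._< ⟦ 2 ⟧) (sym r≡0) 0<⟦2⟧
  ... | inj₂ (i , r≡ei) = subst (0ℚ ℚ.≤_) (sym r≡ei) (proj₁ (proj₂ (column i))) ,
                          subst (ℚ._< ⟦ 2 ⟧) (sym r≡ei) (proj₂ (proj₂ (column i)))

-- Moving D k from row 2 to row 1 in every column k
-- keeps all column sums; when Σ D = 0 it keeps the row sums too.  If both
-- X + D and X - D stay non-negative, X is their midpoint, so at a vertex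
-- the perturbation must vanish.

shift : ∀ {n} → Mat n → (Fin n → ℚ) → Mat n
shift X D zero       k = X Row1 k ℚ.+ D k
shift X D (suc zero) k = X Row2 k ℚ.- D k

Absorbs : ℚ → ℚ → Set
Absorbs x d = 0ℚ ℚ.≤ x ℚ.+ d × 0ℚ ℚ.≤ x ℚ.- d

absorbs-neg : ∀ {x d} → Absorbs x d → Absorbs x (ℚ.- d)
absorbs-neg {x} {d} (up , down) =
  down , subst (λ d′ → 0ℚ ℚ.≤ x ℚ.+ d′) (sym (⁻¹-involutive d)) up

absorbs-small : ∀ {x d} → 0ℚ ℚ.≤ d → d ℚ.≤ x → Absorbs x d
absorbs-small {x} {d} 0≤d d≤x =
  ℚP.≤-trans (ℚP.≤-trans 0≤d d≤x) (≤-+-nonNeg x 0≤d) ,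
  subst (ℚ._≤ x ℚ.- d) (ℚP.+-inverseʳ d) (ℚP.+-monoˡ-≤ (ℚ.- d) d≤x)

absorbs-zero : ∀ {x} → 0ℚ ℚ.≤ x → Absorbs x 0ℚ
absorbs-zero {x} 0≤x = 0≤x+0 , 0≤x+0
  where
  0≤x+0 : 0ℚ ℚ.≤ x ℚ.+ 0ℚ
  0≤x+0 = subst (0ℚ ℚ.≤_) (sym (ℚP.+-identityʳ x)) 0≤x

shift-InP : ∀ {a b} {X : Mat (a + b + 1)} {D : Fin (a + b + 1) → ℚ} →
            InP a b X → Σℚ D ≡ 0ℚ → (∀ μ k → Absorbs (X μ k) (D k)) → InP a b (shift X D)
shift-InP {a} {b} {X} {D} (_ , row1 , row2 , column) ΣD≡0 absorbs =
  nonNeg , row1′ , row2′ , column′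
  where
  nonNeg : ∀ μ k → 0ℚ ℚ.≤ shift X D μ k
  nonNeg zero       k = proj₁ (absorbs Row1 k)
  nonNeg (suc zero) k = proj₂ (absorbs Row2 k)
  row1′ : Σℚ (shift X D Row1) ≡ ⟦ 2 * a + 1 ⟧
  row1′ = begin
    Σℚ (shift X D Row1)        ≡⟨ Σ-+ (X Row1) D ⟩
    Σℚ (X Row1) ℚ.+ Σℚ D       ≡⟨ cong (Σℚ (X Row1) ℚ.+_) ΣD≡0 ⟩
    Σℚ (X Row1) ℚ.+ 0ℚ         ≡⟨ ℚP.+-identityʳ _ ⟩
    Σℚ (X Row1)                ≡⟨ row1 ⟩
    ⟦ 2 * a + 1 ⟧              ∎
  row2′ : Σℚ (shift X D Row2) ≡ ⟦ 2 * b + 1 ⟧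
  row2′ = begin
    Σℚ (shift X D Row2)        ≡⟨ Σ-− (X Row2) D ⟩
    Σℚ (X Row2) ℚ.- Σℚ D       ≡⟨ cong (λ s → Σℚ (X Row2) ℚ.- s) ΣD≡0 ⟩
    Σℚ (X Row2) ℚ.+ 0ℚ         ≡⟨ ℚP.+-identityʳ _ ⟩
    Σℚ (X Row2)                ≡⟨ row2 ⟩
    ⟦ 2 * b + 1 ⟧              ∎
  open +-*-Solver using (solve; _:=_; _:+_; _:-_)
  moved : ∀ x y d → (x ℚ.+ d) ℚ.+ (y ℚ.- d) ≡ x ℚ.+ y
  moved = solve 3 (λ x y d → (x :+ d) :+ (y :- d) := x :+ y) refl
  column′ : ∀ k → shift X D Row1 k ℚ.+ shift X D Row2 k ≡ ⟦ 2 ⟧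
  column′ k = trans (moved (X Row1 k) (X Row2 k) (D k)) (column k)

vertex-rigid : ∀ {a b} {X : Mat (a + b + 1)} (D : Fin (a + b + 1) → ℚ) →
               IsVertex a b X → Σℚ D ≡ 0ℚ → (∀ μ k → Absorbs (X μ k) (D k)) →
               ∀ k → D k ≡ 0ℚ
vertex-rigid {a} {b} {X} D (inP , extreme) ΣD≡0 absorbs k =
  self-negative⇒0 (+-cancelˡ (X Row1 k) (extreme Y Z ½ inY inZ (ℚP.positive⁻¹ ½) ½<1 midpoint Row1 k))
  where
  -D : Fin (a + b + 1) → ℚ
  -D k = ℚ.- D k
  Y Z : Mat (a + b + 1)
  Y = shift X D
  Z = shift X -D
  inY : InP a b Y
  inY = shift-InP {a} {b} inP ΣD≡0 absorbs
  inZ : InP a b Z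
  inZ = shift-InP {a} {b} inP (trans (Σ-neg D) (cong ℚ.-_ ΣD≡0)) (λ μ k → absorbs-neg {X μ k} (absorbs μ k))
  ½<1 : ½ ℚ.< 1ℚ
  ½<1 = toWitness {a? = ½ ℚP.<? 1ℚ} tt
  open +-*-Solver using (solve; _:=_; _:+_; _:-_; _:*_; :-_; con)
  midpoint : ∀ μ k → X μ k ≡ ½ ℚ.* Y μ k ℚ.+ (1ℚ ℚ.- ½) ℚ.* Z μ k
  midpoint zero k = solve 2 (λ x d → x := con ½ :* (x :+ d) :+ (con 1ℚ :- con ½) :* (x :+ :- d))
                            refl (X Row1 k) (D k)
  midpoint (suc zero) k = solve 2 (λ x d → x := con ½ :* (x :- d) :+ (con 1ℚ :- con ½) :* (x :- :- d))
                                  refl (X Row2 k) (D k)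

Mixed : ∀ {n} → Mat n → Fin n → Set
Mixed X k = 0ℚ ℚ.< X Row1 k × 0ℚ ℚ.< X Row2 k

colMin : ∀ {n} → Mat n → Fin n → ℚ
colMin X k = X Row1 k ℚ.⊓ X Row2 k

colMin-≤ : ∀ {n} (X : Mat n) k μ → colMin X k ℚ.≤ X μ k
colMin-≤ X k zero       = ℚP.p⊓q≤p (X Row1 k) (X Row2 k)
colMin-≤ X k (suc zero) = ℚP.p⊓q≤q (X Row1 k) (X Row2 k)

⊓-pos : ∀ {p q} → 0ℚ ℚ.< p → 0ℚ ℚ.< q → 0ℚ ℚ.< p ℚ.⊓ q
⊓-pos {p} {q} 0<p 0<q with ℚP.⊓-sel p q
... | inj₁ p⊓q≡p = subst (0ℚ ℚ.<_) (sym p⊓q≡p) 0<p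
... | inj₂ p⊓q≡q = subst (0ℚ ℚ.<_) (sym p⊓q≡q) 0<q

pointMass : ∀ {n} → Fin n → ℚ → Fin n → ℚ
pointMass i c k with k FinP.≟ i
... | yes _ = c
... | no  _ = 0ℚ

pointMass-at : ∀ {n} (i : Fin n) c → pointMass i c i ≡ c
pointMass-at i c with i FinP.≟ i
... | yes _   = refl
... | no  i≢i = ⊥-elim (i≢i refl)

pointMass-off : ∀ {n} {i k : Fin n} c → k ≢ i → pointMass i c k ≡ 0ℚ
pointMass-off {i = i} {k} c k≢i with k FinP.≟ i
... | yes k≡i = ⊥-elim (k≢i k≡i)
... | no  _   = refl

Σ-pointMass : ∀ {n} (i : Fin n) c → Σℚ (pointMass i c) ≡ c
Σ-pointMass i c = trans (Σ-single (pointMass i c) i (λ k → pointMass-off c)) (pointMass-at i c)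

-- At a vertex at most one column is mixed: for two distinct mixed columns
-- i, j, moving a small ε > 0 into column i and out of column j in row 1
-- (and the reverse in row 2) is a nonzero admissible perturbation.
mixed-atMostOne : ∀ {a b} {X : Mat (a + b + 1)} → IsVertex a b X → AtMostOne (Mixed X)
mixed-atMostOne {a} {b} {X} vertex i j mixed-i mixed-j with i FinP.≟ j
... | yes i≡j = i≡j
... | no  i≢j = ⊥-elim (ℚP.<⇒≢ 0<ε (sym (trans (sym D-at-i) (vertex-rigid {a} {b} D vertex ΣD≡0 absorbs i))))
  where
  ε : ℚ
  ε = colMin X i ℚ.⊓ colMin X j
  0<ε : 0ℚ ℚ.< ε
  0<ε = ⊓-pos (⊓-pos (proj₁ mixed-i) (proj₂ mixed-i)) (⊓-pos (proj₁ mixed-j) (proj₂ mixed-j))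
  0≤ε : 0ℚ ℚ.≤ ε
  0≤ε = ℚP.<⇒≤ 0<ε
  ε≤at-i : ∀ μ → ε ℚ.≤ X μ i
  ε≤at-i μ = ℚP.≤-trans (ℚP.p⊓q≤p (colMin X i) (colMin X j)) (colMin-≤ X i μ)
  ε≤at-j : ∀ μ → ε ℚ.≤ X μ j
  ε≤at-j μ = ℚP.≤-trans (ℚP.p⊓q≤q (colMin X i) (colMin X j)) (colMin-≤ X j μ)
  D : Fin (a + b + 1) → ℚ
  D k = pointMass i ε k ℚ.- pointMass j ε k
  ΣD≡0 : Σℚ D ≡ 0ℚ
  ΣD≡0 = begin
    Σℚ D                                        ≡⟨ Σ-− (pointMass i ε) (pointMass j ε) ⟩
    Σℚ (pointMass i ε) ℚ.- Σℚ (pointMass j ε)   ≡⟨ cong₂ ℚ._-_ (Σ-pointMass i ε) (Σ-pointMass j ε) ⟩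
    ε ℚ.- ε                                     ≡⟨ ℚP.+-inverseʳ ε ⟩
    0ℚ                                          ∎
  D-at-i : D i ≡ ε
  D-at-i = trans (cong₂ ℚ._-_ (pointMass-at i ε) (pointMass-off ε i≢j)) (ℚP.+-identityʳ ε)
  D-at-j : D j ≡ ℚ.- ε
  D-at-j = trans (cong₂ ℚ._-_ (pointMass-off ε (i≢j ∘ sym)) (pointMass-at j ε)) (ℚP.+-identityˡ (ℚ.- ε))
  absorbs : ∀ μ k → Absorbs (X μ k) (D k)
  absorbs μ k = by-cases (k FinP.≟ i) (k FinP.≟ j)
    where
    by-cases : Dec (k ≡ i) → Dec (k ≡ j) → Absorbs (X μ k) (D k)
    by-cases (yes k≡i) _ = subst (λ k → Absorbs (X μ k) (D k)) (sym k≡i)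
      (subst (Absorbs (X μ i)) (sym D-at-i) (absorbs-small 0≤ε (ε≤at-i μ)))
    by-cases (no _) (yes k≡j) = subst (λ k → Absorbs (X μ k) (D k)) (sym k≡j)
      (subst (Absorbs (X μ j)) (sym D-at-j) (absorbs-neg {X μ j} (absorbs-small 0≤ε (ε≤at-j μ))))
    by-cases (no k≢i) (no k≢j) =
      subst (Absorbs (X μ k)) (sym (cong₂ ℚ._-_ (pointMass-off ε k≢i) (pointMass-off ε k≢j)))
            (absorbs-zero (proj₁ (proj₁ vertex) μ k))

∈⇔lookup : ∀ {n} (S : Subset n) (k : Fin n) → k ∈ S ⇔ lookup S k ≡ true
∈⇔lookup S k = mk⇔ VecP.[]=⇒lookup (VecP.lookup⇒[]= k S)

column-excess : ∀ {p q} (s : Bool) → 0ℚ ℚ.≤ p → 0ℚ ℚ.≤ q → p ℚ.+ q ≡ ⟦ 2 ⟧ →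
                (s ≡ true ⇔ q ≡ 0ℚ) → Admissible (0ℚ ℚ.< p × 0ℚ ℚ.< q) (p ℚ.- twoIf s)
column-excess {p} {q} true 0≤p 0≤q p+q≡2 s⇔q≡0 =
  inj₁ e≡0 , ℚP.≤-reflexive (sym e≡0) , subst (ℚ._< ⟦ 2 ⟧) (sym e≡0) 0<⟦2⟧
  where
  p≡2 : p ≡ ⟦ 2 ⟧
  p≡2 = begin
    p          ≡⟨ ℚP.+-identityʳ p ⟨
    p ℚ.+ 0ℚ   ≡⟨ cong (p ℚ.+_) (Equivalence.to s⇔q≡0 refl) ⟨
    p ℚ.+ q    ≡⟨ p+q≡2 ⟩
    ⟦ 2 ⟧      ∎
  e≡0 : p ℚ.- ⟦ 2 ⟧ ≡ 0ℚ
  e≡0 = trans (cong (ℚ._- ⟦ 2 ⟧) p≡2) (ℚP.+-inverseʳ ⟦ 2 ⟧)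
column-excess {p} {q} false 0≤p 0≤q p+q≡2 s⇔q≡0 =
  subst (Admissible (0ℚ ℚ.< p × 0ℚ ℚ.< q)) (sym (ℚP.+-identityʳ p)) (split-on-zero (p ℚ.≟ 0ℚ))
  where
  q≢0 : q ≢ 0ℚ
  q≢0 q≡0 with () ← Equivalence.from s⇔q≡0 q≡0
  p≢2 : p ≢ ⟦ 2 ⟧
  p≢2 p≡2 = q≢0 (+-cancelˡ ⟦ 2 ⟧ (trans (subst (λ p → p ℚ.+ q ≡ ⟦ 2 ⟧) p≡2 p+q≡2)
                                       (sym (ℚP.+-identityʳ ⟦ 2 ⟧))))
  p<2 : p ℚ.< ⟦ 2 ⟧
  p<2 = ≤∧≢⇒< (subst (p ℚ.≤_) p+q≡2 (≤-+-nonNeg p 0≤q)) p≢2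
  split-on-zero : Dec (p ≡ 0ℚ) → Admissible (0ℚ ℚ.< p × 0ℚ ℚ.< q) p
  split-on-zero (yes p≡0) = inj₁ p≡0 , 0≤p , p<2
  split-on-zero (no  p≢0) = inj₂ (≤∧≢⇒< 0≤p (p≢0 ∘ sym) , ≤∧≢⇒< 0≤q (q≢0 ∘ sym)) , 0≤p , p<2

module FacetToSets {a b : ℕ} {SU SV : Subset (a + b + 1)} {X : Mat (a + b + 1)}
  (vertex : IsVertex a b X)
  (zeros : ∀ ν → (ν ∈ SU ⇔ X Row1 ν ≡ 0ℚ) × (ν ∈ SV ⇔ X Row2 ν ≡ 0ℚ)) where

  private
    nonNeg = proj₁ (proj₁ vertex)
    row1   = proj₁ (proj₂ (proj₁ vertex))
    row2   = proj₁ (proj₂ (proj₂ (proj₁ vertex)))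
    column = proj₂ (proj₂ (proj₂ (proj₁ vertex)))

  cardV : ∣ SV ∣ ≡ a
  cardV = card-from-rowSum (X Row1) SV (Mixed X) a (mixed-atMostOne {a} {b} vertex) excess-ok row1
    where
    excess-ok : ∀ ν → Admissible (Mixed X ν) (excess (X Row1) SV ν)
    excess-ok ν = column-excess (lookup SV ν) (nonNeg Row1 ν) (nonNeg Row2 ν) (column ν)
                    (⇔.trans (⇔.sym (∈⇔lookup SV ν)) (proj₂ (zeros ν)))

  cardU : ∣ SU ∣ ≡ b
  cardU = card-from-rowSum (X Row2) SU (λ ν → 0ℚ ℚ.< X Row2 ν × 0ℚ ℚ.< X Row1 ν) b
            (λ i j mixed-i mixed-j → mixed-atMostOne {a} {b} vertex i j (swap mixed-i) (swap mixed-j))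
            excess-ok row2
    where
    excess-ok : ∀ ν → Admissible (0ℚ ℚ.< X Row2 ν × 0ℚ ℚ.< X Row1 ν) (excess (X Row2) SU ν)
    excess-ok ν = column-excess (lookup SU ν) (nonNeg Row2 ν) (nonNeg Row1 ν)
                    (trans (ℚP.+-comm (X Row2 ν) (X Row1 ν)) (column ν))
                    (⇔.trans (⇔.sym (∈⇔lookup SU ν)) (proj₁ (zeros ν)))

  -- a column cannot vanish in both rows, since it sums to 2
  disjoint : SU ∩ SV ≡ ⊥
  disjoint = Empty-unique λ { (ν , ν∈SU∩SV) → ℚP.<⇒≢ 0<⟦2⟧ (trans
    (sym (cong₂ ℚ._+_ (Equivalence.to (proj₁ (zeros ν)) (p∩q⊆p SU SV ν∈SU∩SV))
                      (Equivalence.to (proj₂ (zeros ν)) (p∩q⊆q SU SV ν∈SU∩SV))))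
    (column ν)) }

-- A point of P in which every column except one has a zero entry is a
-- vertex: in a convex combination X = t Y + (1 - t) Z the zero entries of
-- X are zero in Y and Z, so Y and Z agree on those columns (column sums
-- are 2), and then also on the remaining column (row sums are equal).

column-determined : ∀ {n} (Y Z : Mat n) k →
  Y Row1 k ℚ.+ Y Row2 k ≡ Z Row1 k ℚ.+ Z Row2 k →
  ∀ μ → Y μ k ≡ Z μ k → ∀ μ′ → Y μ′ k ≡ Z μ′ k
column-determined Y Z k sums zero       e zero       = e
column-determined Y Z k sums zero       e (suc zero) =
  +-cancelˡ (Z Row1 k) (trans (cong (ℚ._+ Y Row2 k) (sym e)) sums)
column-determined Y Z k sums (suc zero) e zero       =
  +-cancelʳ (Z Row2 k) (trans (cong (Y Row1 k ℚ.+_) (sym e)) sums)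
column-determined Y Z k sums (suc zero) e (suc zero) = e

vertex-criterion : ∀ {a b} {X : Mat (a + b + 1)} → InP a b X → (i : Fin (a + b + 1)) →
                   (∀ k → k ≢ i → ∃ λ μ → X μ k ≡ 0ℚ) → IsVertex a b X
vertex-criterion {a} {b} {X} inP i zero-entry = inP , extreme
  where
  extreme : ∀ (Y Z : Mat (a + b + 1)) t → InP a b Y → InP a b Z → 0ℚ ℚ.< t → t ℚ.< 1ℚ →
            (∀ μ ν → X μ ν ≡ t ℚ.* Y μ ν ℚ.+ (1ℚ ℚ.- t) ℚ.* Z μ ν) → ∀ μ ν → Y μ ν ≡ Z μ ν
  extreme Y Z t (nonNegY , rowY , _ , columnY) (nonNegZ , rowZ , _ , columnZ) 0<t t<1 convex μ k =
    column-determined Y Z k same-sums Row1 (row1-agree k) μ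
    where
    same-sums : ∀ {k} → Y Row1 k ℚ.+ Y Row2 k ≡ Z Row1 k ℚ.+ Z Row2 k
    same-sums {k} = trans (columnY k) (sym (columnZ k))
    column-agree : ∀ k → (∃ λ μ → X μ k ≡ 0ℚ) → ∀ μ′ → Y μ′ k ≡ Z μ′ k
    column-agree k (μ , Xμk≡0) = column-determined Y Z k same-sums μ (trans Yμk≡0 (sym Zμk≡0))
      where
      both-zero = convex-zero 0<t t<1 (nonNegY μ k) (nonNegZ μ k) (trans (sym (convex μ k)) Xμk≡0)
      Yμk≡0 = proj₁ both-zero
      Zμk≡0 = proj₂ both-zero
    row1-agree : ∀ k → Y Row1 k ≡ Z Row1 k
    row1-agree k with k FinP.≟ i
    ... | yes refl = Σ-agree-at (Y Row1) (Z Row1) i (λ k k≢i → column-agree k (zero-entry k k≢i) Row1)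
                                (trans rowY (sym rowZ))
    ... | no  k≢i  = column-agree k (zero-entry k k≢i) Row1

-- Given disjoint SU, SV with ∣ SV ∣ = a and ∣ SU ∣ = b,
-- put 0 in row 1 over SU, 0 in row 2 over SV, and 1 in both rows of the
-- remaining free columns.

Disjoint : ∀ {n} → Subset n → Subset n → Set
Disjoint {n} u v = ∀ (k : Fin n) → lookup u k ≡ true → lookup v k ≡ true → Empty.⊥

∩≡⊥⇒Disjoint : ∀ {n} (u v : Subset n) → u ∩ v ≡ ⊥ → Disjoint u v
∩≡⊥⇒Disjoint u v u∩v≡⊥ k uk vk with () ← (begin
  true                       ≡⟨ cong₂ _∧_ uk vk ⟨
  lookup u k ∧ lookup v k    ≡⟨ VecP.lookup-zipWith _∧_ k u v ⟨
  lookup (u ∩ v) k           ≡⟨ cong (λ w → lookup w k) u∩v≡⊥ ⟩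
  lookup ⊥ k                 ≡⟨ VecP.lookup-replicate k false ⟩
  false                      ∎)

weight : Bool → Bool → ℕ
weight true  _     = 0
weight false true  = 2
weight false false = 1

weight-column : ∀ x y → (x ≡ true → y ≡ true → Empty.⊥) → weight x y + weight y x ≡ 2
weight-column true  true  disjoint = ⊥-elim (disjoint refl refl)
weight-column true  false disjoint = refl
weight-column false true  disjoint = refl
weight-column false false disjoint = refl

weight-zero : ∀ x y → x ≡ true ⇔ ⟦ weight x y ⟧ ≡ 0ℚ
weight-zero true  y     = mk⇔ (λ _ → refl) (λ _ → refl)
weight-zero false true  = mk⇔ (λ ()) (λ w≡0 → case-absurd (⟦⟧≡0⇒≡0 w≡0))
  where case-absurd : 2 ≡ 0 → false ≡ true
        case-absurd ()
weight-zero false false = mk⇔ (λ ()) (λ w≡0 → case-absurd (⟦⟧≡0⇒≡0 w≡0))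
  where case-absurd : 1 ≡ 0 → false ≡ true
        case-absurd ()

#free : ∀ {n} → Subset n → Subset n → ℕ
#free []          []          = 0
#free (true  ∷ u) (_     ∷ v) = #free u v
#free (false ∷ u) (true  ∷ v) = #free u v
#free (false ∷ u) (false ∷ v) = suc (#free u v)

partition : ∀ {n} (u v : Subset n) → Disjoint u v → ∣ u ∣ + ∣ v ∣ + #free u v ≡ n
partition []          []          d = refl
partition (true  ∷ u) (true  ∷ v) d = ⊥-elim (d zero refl refl)
partition (true  ∷ u) (false ∷ v) d = cong suc (partition u v (λ k → d (suc k)))
partition (false ∷ u) (true  ∷ v) d =
  trans (cong (_+ #free u v) (ℕP.+-suc ∣ u ∣ ∣ v ∣)) (cong suc (partition u v (λ k → d (suc k))))
partition (false ∷ u) (false ∷ v) d =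
  trans (ℕP.+-suc (∣ u ∣ + ∣ v ∣) (#free u v)) (cong suc (partition u v (λ k → d (suc k))))

Σ-weight : ∀ {n} (u v : Subset n) → Disjoint u v →
           Σℚ (λ k → ⟦ weight (lookup u k) (lookup v k) ⟧) ≡ ⟦ 2 * ∣ v ∣ + #free u v ⟧
Σ-weight []          []          d = refl
Σ-weight (true  ∷ u) (true  ∷ v) d = ⊥-elim (d zero refl refl)
Σ-weight (true  ∷ u) (false ∷ v) d = trans (ℚP.+-identityˡ _) (Σ-weight u v (λ k → d (suc k)))
Σ-weight (false ∷ u) (true  ∷ v) d = add-column 2 (Σ-weight u v (λ k → d (suc k)))
  (trans (sym (ℕP.+-assoc 2 (2 * ∣ v ∣) (#free u v))) (cong (_+ #free u v) (sym (ℕP.*-suc 2 ∣ v ∣))))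
  where
  add-column : ∀ w {x N N′} → x ≡ ⟦ N ⟧ → w + N ≡ N′ → ⟦ w ⟧ ℚ.+ x ≡ ⟦ N′ ⟧
  add-column w {N = N} x≡N w+N≡N′ =
    trans (cong (⟦ w ⟧ ℚ.+_) x≡N) (trans (sym (⟦⟧-+ w N)) (cong ⟦_⟧ w+N≡N′))
Σ-weight (false ∷ u) (false ∷ v) d =
  trans (cong (⟦ 1 ⟧ ℚ.+_) (Σ-weight u v (λ k → d (suc k))))
        (trans (sym (⟦⟧-+ 1 (2 * ∣ v ∣ + #free u v))) (cong ⟦_⟧ (sym (ℕP.+-suc (2 * ∣ v ∣) (#free u v)))))

Covered : ∀ {n} → Subset n → Subset n → Fin n → Set
Covered u v k = lookup u k ≡ true ⊎ lookup v k ≡ true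

no-free-column : ∀ {n} (u v : Subset n) → #free u v ≡ 0 → ∀ k → Covered u v k
no-free-column (true  ∷ u) (_     ∷ v) none zero    = inj₁ refl
no-free-column (true  ∷ u) (_     ∷ v) none (suc k) = no-free-column u v none k
no-free-column (false ∷ u) (true  ∷ v) none zero    = inj₂ refl
no-free-column (false ∷ u) (true  ∷ v) none (suc k) = no-free-column u v none k
no-free-column (false ∷ u) (false ∷ v) ()   k

one-free-column : ∀ {n} (u v : Subset n) → #free u v ≡ 1 → ∃ λ i → ∀ k → k ≢ i → Covered u v k
one-free-column [] [] ()
one-free-column (true ∷ u) (_ ∷ v) one with one-free-column u v one
... | i , covered = suc i , λ { zero _ → inj₁ refl ; (suc k) k≢i → covered k (k≢i ∘ cong suc) }
one-free-column (false ∷ u) (true ∷ v) one with one-free-column u v one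
... | i , covered = suc i , λ { zero _ → inj₂ refl ; (suc k) k≢i → covered k (k≢i ∘ cong suc) }
one-free-column (false ∷ u) (false ∷ v) one =
  zero , λ { zero 0≢0 → ⊥-elim (0≢0 refl) ; (suc k) _ → no-free-column u v (ℕP.suc-injective one) k }

canonical : ∀ {n} → Subset n → Subset n → Mat n
canonical SU SV zero       ν = ⟦ weight (lookup SU ν) (lookup SV ν) ⟧
canonical SU SV (suc zero) ν = ⟦ weight (lookup SV ν) (lookup SU ν) ⟧

module SetsToFacet {a b : ℕ} {SU SV : Subset (a + b + 1)}
  (cardV : ∣ SV ∣ ≡ a) (cardU : ∣ SU ∣ ≡ b) (SU∩SV≡⊥ : SU ∩ SV ≡ ⊥) where

  private
    X = canonical SU SV
    SU⊥SV : Disjoint SU SV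
    SU⊥SV = ∩≡⊥⇒Disjoint SU SV SU∩SV≡⊥
    SV⊥SU : Disjoint SV SU
    SV⊥SU k v u = SU⊥SV k u v

    one-free : ∀ u v → Disjoint u v → ∣ u ∣ + ∣ v ∣ + 1 ≡ a + b + 1 → #free u v ≡ 1
    one-free u v d sizes = ℕP.+-cancelˡ-≡ (∣ u ∣ + ∣ v ∣) (#free u v) 1 (trans (partition u v d) (sym sizes))

    free-UV : #free SU SV ≡ 1
    free-UV = one-free SU SV SU⊥SV (cong (_+ 1) (trans (cong₂ _+_ cardU cardV) (ℕP.+-comm b a)))
    free-VU : #free SV SU ≡ 1
    free-VU = one-free SV SU SV⊥SU (cong (_+ 1) (cong₂ _+_ cardV cardU))

    nonNeg : ∀ μ ν → 0ℚ ℚ.≤ X μ ν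
    nonNeg zero       ν = ⟦⟧-nonNeg (weight (lookup SU ν) (lookup SV ν))
    nonNeg (suc zero) ν = ⟦⟧-nonNeg (weight (lookup SV ν) (lookup SU ν))

    inP : InP a b X
    inP = nonNeg ,
          trans (Σ-weight SU SV SU⊥SV) (cong ⟦_⟧ (cong₂ (λ s f → 2 * s + f) cardV free-UV)) ,
          trans (Σ-weight SV SU SV⊥SU) (cong ⟦_⟧ (cong₂ (λ s f → 2 * s + f) cardU free-VU)) ,
          column
      where
      column : ∀ ν → X Row1 ν ℚ.+ X Row2 ν ≡ ⟦ 2 ⟧
      column ν = trans (sym (⟦⟧-+ (weight (lookup SU ν) (lookup SV ν)) (weight (lookup SV ν) (lookup SU ν))))
                       (cong ⟦_⟧ (weight-column (lookup SU ν) (lookup SV ν) (SU⊥SV ν)))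

    zeros : ∀ ν → (ν ∈ SU ⇔ X Row1 ν ≡ 0ℚ) × (ν ∈ SV ⇔ X Row2 ν ≡ 0ℚ)
    zeros ν = ⇔.trans (∈⇔lookup SU ν) (weight-zero _ _) , ⇔.trans (∈⇔lookup SV ν) (weight-zero _ _)

    zero-entry : ∀ k → Covered SU SV k → ∃ λ μ → X μ k ≡ 0ℚ
    zero-entry k (inj₁ k∈SU) = Row1 , Equivalence.to (weight-zero _ _) k∈SU
    zero-entry k (inj₂ k∈SV) = Row2 , Equivalence.to (weight-zero _ _) k∈SV

  facet : IsFacetΔ a b SU SV
  facet = X , vertex-criterion {a} {b} inP free (λ k k≢free → zero-entry k (covered k k≢free)) , zeros
    where
    free = proj₁ (one-free-column SU SV free-UV)
    covered = proj₂ (one-free-column SU SV free-UV)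

lemma3p2 : (a b : ℕ) → 1 ≤ a → 1 ≤ b →
    (SU SV : Subset (a + b + 1)) →
    IsFacetΔ a b SU SV ⇔ ((∣ SV ∣ ≡ a) × (∣ SU ∣ ≡ b) × (SU ∩ SV ≡ ⊥))
lemma3p2 a b _ _ SU SV = mk⇔
  (λ { (X , vertex , zeros) → let open FacetToSets {a} {b} vertex zeros in cardV , cardU , disjoint })
  (λ { (cardV , cardU , disjoint) → SetsToFacet.facet {a} {b} cardV cardU disjoint })
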